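{- Let $t\ge1$ be an integer and let $\mathcal{G}$ be a class of graphs with $\chi^l_\star(\mathcal{G})\le t$. Then there exists $m\ge1$ such that $K_{t,m}\notin\mathcal{G}$ and $I_{t-1}+P_m\notin\mathcal{G}$.
   Context: $I_n+P_m$ denotes a path on $m$ vertices together with $n$ additional pairwise non-adjacent vertices each adjacent to all vertices of the path. A $t$-list assignment $L$ assigns to each vertex $v$ a finite set $L(v)$ with $|L(v)|\ge t$; an $L$-coloring with clustering $C$ assigns each $v$ a color from $L(v)$ so that every monochromatic connected subgraph has at most $C$ vertices; $\chi^l_C(G)$ is the minimum $t$ such that $G$ has an $L$-coloring with clustering $C$ for every $t$-list assignment $L$. $\chi^l_\star(\mathcal{G})$ is the minimum $t$ such that there exists $C$ with $\chi^l_C(G)\le t$ for every $G\in\mathcal{G}$ ($\infty$ if none). -}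

module Defs where

open import Data.Nat using (ℕ; zero; suc; _≤_; _<ᵇ_; _≡ᵇ_)
open import Data.Bool using (Bool; true; false; _xor_; _∧_; _∨_; not; if_then_else_)
open import Data.Fin using (Fin; toℕ)
open import Data.Fin.Subset using (Subset; _∈_; ∣_∣)
open import Data.List using (List; length)
open import Data.List.Relation.Unary.Unique.Propositional using (Unique)
import Data.List.Membership.Propositional as LM
open import Data.Product using (Σ; ∃; _×_; _,_)
open import Relation.Binary.PropositionalEquality using (_≡_; refl)
open import Function.Bundles using (_↔_; Inverse)

record Graph : Set where
  field
    n       : ℕ
    adj     : Fin n → Fin n → Bool
    adj-sym : ∀ u v → adj u v ≡ adj v u
    irrefl  : ∀ v → adj v v ≡ false
open Graph public

record _≅_ (G H : Graph) : Set where
  field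
    bij      : Fin (n G) ↔ Fin (n H)
    preserve : ∀ u v → adj G u v ≡ adj H (Inverse.to bij u) (Inverse.to bij v)

-- Colours are natural numbers; a list assignment gives each vertex a
-- finite set of colours, represented as a duplicate-free list.
record ListAssignment (t : ℕ) (G : Graph) : Set where
  field
    L        : Fin (n G) → List ℕ
    distinct : ∀ v → Unique (L v)
    big      : ∀ v → t ≤ length (L v)
open ListAssignment public

data ReachIn (G : Graph) (S : Subset (n G)) : Fin (n G) → Fin (n G) → Set where
  here : ∀ {u} → u ∈ S → ReachIn G S u u
  step : ∀ {u w v} → u ∈ S → adj G u w ≡ true → ReachIn G S w v → ReachIn G S u v

ConnectedIn : (G : Graph) → Subset (n G) → Set
ConnectedIn G S = ∀ u v → u ∈ S → v ∈ S → ReachIn G S u v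

Monochromatic : (G : Graph) → (Fin (n G) → ℕ) → Subset (n G) → Set
Monochromatic G c S = ∀ u v → u ∈ S → v ∈ S → c u ≡ c v

-- c has clustering C: every monochromatic connected subgraph has at most
-- C vertices (a monochromatic connected subgraph with vertex set S exists
-- iff S is monochromatic and G[S] is connected).
HasClustering : (G : Graph) → ℕ → (Fin (n G) → ℕ) → Set
HasClustering G C c =
  ∀ (S : Subset (n G)) → Monochromatic G c S → ConnectedIn G S → ∣ S ∣ ≤ C

LColouring : (G : Graph) {t : ℕ} → ListAssignment t G → ℕ → Set
LColouring G L C =
  Σ (Fin (n G) → ℕ) λ c → (∀ v → c v LM.∈ ListAssignment.L L v) × HasClustering G C c

-- χ^l_C(G) ≤ t  (the defining property is monotone in t, so χ^l_C(G) ≤ t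
-- iff every t-list assignment admits an L-colouring with clustering C)
χˡ≤ : ℕ → Graph → ℕ → Set
χˡ≤ C G t = (L : ListAssignment t G) → LColouring G L C

χˡ⋆≤ : (Graph → Set) → ℕ → Set
χˡ⋆≤ 𝒢 t = ∃ λ C → ∀ G → 𝒢 G → χˡ≤ C G t

private
  xor-self : ∀ b → b xor b ≡ false
  xor-self true = refl
  xor-self false = refl

  xor-comm : ∀ a b → a xor b ≡ b xor a
  xor-comm true true = refl
  xor-comm true false = refl
  xor-comm false true = refl
  xor-comm false false = refl

  ∨-comm : ∀ a b → a ∨ b ≡ b ∨ a
  ∨-comm true true = refl
  ∨-comm true false = refl
  ∨-comm false true = refl
  ∨-comm false false = refl

  sx≡ᵇx : ∀ x → (suc x ≡ᵇ x) ≡ false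
  sx≡ᵇx zero = refl
  sx≡ᵇx (suc x) = sx≡ᵇx x

  ite-cong : ∀ (b : Bool) {x y z w : Bool} → x ≡ y → z ≡ w →
             (if b then x else z) ≡ (if b then y else w)
  ite-cong b refl refl = refl

K : ℕ → ℕ → Graph
K s m = record
  { n = s Data.Nat.+ m
  ; adj = λ u v → (toℕ u <ᵇ s) xor (toℕ v <ᵇ s)
  ; adj-sym = λ u v → xor-comm (toℕ u <ᵇ s) (toℕ v <ᵇ s)
  ; irrefl = λ v → xor-self (toℕ v <ᵇ s)
  }

pathAdj : ℕ → ℕ → Bool
pathAdj i j = (suc i ≡ᵇ j) ∨ (suc j ≡ᵇ i)

-- I_s + P_m: vertices 0..s-1 are the independent vertices, s..s+m-1 form
-- the path (in order); each independent vertex is adjacent to every path vertex.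
IP : ℕ → ℕ → Graph
IP s m = record
  { n = s Data.Nat.+ m
  ; adj = λ u v → if (toℕ u <ᵇ s) ∨ (toℕ v <ᵇ s)
                    then (toℕ u <ᵇ s) xor (toℕ v <ᵇ s)
                    else pathAdj (toℕ u) (toℕ v)
  ; adj-sym = λ u v → symm u v
  ; irrefl = λ v → irr v
  }
  where
  symm : ∀ (u v : Fin (s Data.Nat.+ m)) →
    (if (toℕ u <ᵇ s) ∨ (toℕ v <ᵇ s) then (toℕ u <ᵇ s) xor (toℕ v <ᵇ s)
       else pathAdj (toℕ u) (toℕ v))
    ≡ (if (toℕ v <ᵇ s) ∨ (toℕ u <ᵇ s) then (toℕ v <ᵇ s) xor (toℕ u <ᵇ s)
       else pathAdj (toℕ v) (toℕ u))
  symm u v with (toℕ u <ᵇ s) | (toℕ v <ᵇ s)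
  ... | true  | true  = refl
  ... | true  | false = refl
  ... | false | true  = refl
  ... | false | false = ∨-comm (suc (toℕ u) ≡ᵇ toℕ v) (suc (toℕ v) ≡ᵇ toℕ u)
  irr : ∀ (v : Fin (s Data.Nat.+ m)) →
    (if (toℕ v <ᵇ s) ∨ (toℕ v <ᵇ s) then (toℕ v <ᵇ s) xor (toℕ v <ᵇ s)
       else pathAdj (toℕ v) (toℕ v)) ≡ false
  irr v with (toℕ v <ᵇ s)
  ... | true = refl
  ... | false rewrite sx≡ᵇx (toℕ v) = refl

-- Fix the clustering bound C and take m large. On K_{t,m} and on I_{t-1}+P_m give the hubs (the
-- t, resp. t - 1, vertices of the small side) pairwise disjoint lists, and split the rest into
-- groups, one for every choice of a colour per hub, whose lists are exactly those colours (plus one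
-- spare colour on I_{t-1}+P_m). In any colouring, look at the group matching the hubs' actual
-- colours and cut it into tC + 1 rows of C + 1 vertices. If every row has a vertex coloured like a
-- hub, pigeonhole gives C + 1 of them sharing a hub, and they form a monochromatic star with it;
-- otherwise some row is all spare-coloured, which on I_{t-1}+P_m is a monochromatic path. Hence a
-- graph of 𝒢 isomorphic to either would have no colouring with clustering C.

module Submission where

open import Defs
open import Data.Bool using (true; false)
import Data.Bool.Properties as Bool
open import Data.Fin using (Fin; toℕ; inject₁; fromℕ; _↑ˡ_; _↑ʳ_; combine; remainder; quotient; splitAt;
  finToFun; funToFin) renaming (zero to fzero; suc to fsuc)
open import Data.Fin.Properties using (any?; all?; ¬∀⟶∃¬; toℕ-injective; toℕ<n; toℕ-combine; toℕ-inject₁;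
  toℕ-↑ʳ; ↑ʳ-injective; splitAt-↑ˡ; splitAt-↑ʳ; remQuot-combine; combine-injectiveˡ; combine-injectiveʳ;
  finToFun-funToFin) renaming (_≟_ to _≟ᶠ_)
open import Data.Fin.Subset using (Subset; _∈_; ∣_∣; outside; _⊂_)
open import Data.Fin.Subset.Properties using (p⊂q⇒∣p∣<∣q∣; _∈?_)
open import Data.List using (List; []; _∷_; _++_; length; map; filter; allFin; upTo)
open import Data.List.Properties using (length-map; length-tabulate; length-upTo; length-++; map-cong)
open import Data.List.Membership.Propositional using () renaming (_∈_ to _∈ₗ_)
open import Data.List.Membership.Propositional.Properties using (∈-map⁻; ∈-++⁻; ∈-allFin)
open import Data.List.Relation.Unary.Any using (here; there)
open import Data.List.Relation.Unary.All as All using (All; []; _∷_)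
import Data.List.Relation.Unary.All.Properties as All
open import Data.List.Relation.Unary.AllPairs using ([]; _∷_)
open import Data.List.Relation.Unary.Unique.Propositional using (Unique)
import Data.List.Relation.Unary.Unique.Propositional.Properties as Unique
open import Data.Nat using (ℕ; zero; suc; _+_; _*_; _^_; _∸_; _≤_; _<_; z≤n; s≤s; _≟_; _<?_; _<ᵇ_)
open import Data.Nat.Properties using (+-suc; +-cancelˡ-≡; +-cancelˡ-<; +-monoˡ-≤; *-monoˡ-≤; *-mono-≤;
  ≤-refl; ≤-reflexive; <-≤-trans; <⇒≱; ≮⇒≥; m≤m+n; n<1+n; n≤1+n; m^n>0; module ≤-Reasoning)
open import Data.Product using (Σ; ∃; ∃₂; _×_; _,_; proj₁; proj₂)
open import Data.Sum using (_⊎_; inj₁; inj₂; [_,_]′)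
open import Data.Vec using (tabulate; _[_]≔_)
open import Data.Vec.Properties using (lookup∘tabulate; []=⇒lookup; lookup⇒[]=; lookup∘update; lookup∘update′)
open import Function using (id; _∘_)
open import Function.Bundles using (Inverse)
open import Relation.Binary using (DecidableEquality)
open import Relation.Binary.PropositionalEquality hiding ([_])
open import Relation.Nullary using (¬_; contradiction; Dec; yes; no; does; _×-dec_; _⊎-dec_)
open import Relation.Nullary.Decidable using (dec-true)
open import Relation.Unary using (Pred; Decidable)
open import Relation.Unary.Properties using (∁?)

module _ {n p} {P : Pred (Fin n) p} where

  fromDec : Decidable P → Subset n
  fromDec P? = tabulate (does ∘ P?)

  ∈-fromDec⁺ : (P? : Decidable P) → ∀ {v} → P v → v ∈ fromDec P?
  ∈-fromDec⁺ P? {v} pv = lookup⇒[]= v _ (trans (lookup∘tabulate (does ∘ P?) v) (dec-true (P? v) pv))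

  ∈-fromDec⁻ : (P? : Decidable P) → ∀ {v} → v ∈ fromDec P? → P v
  ∈-fromDec⁻ P? {v} v∈ = witness (P? v) (trans (sym (lookup∘tabulate (does ∘ P?) v)) ([]=⇒lookup v∈))
    where
    witness : (d : Dec (P v)) → does d ≡ true → P v
    witness (yes pv) _ = pv

-- Removing one member of a duplicate-free list from S gives a proper subset of S.
length≤∣∣ : ∀ {n} (S : Subset n) {xs : List (Fin n)} → Unique xs → All (_∈ S) xs → length xs ≤ ∣ S ∣
length≤∣∣ S {[]} _ _ = z≤n
length≤∣∣ {n} S {x ∷ xs} (x∉xs ∷ xs!) (x∈S ∷ xs⊆S) =
  <-≤-trans (s≤s (length≤∣∣ S′ xs! (All.zipWith stays (x∉xs , xs⊆S)))) (p⊂q⇒∣p∣<∣q∣ S′⊂S)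
  where
  S′ : Subset n
  S′ = S [ x ]≔ outside
  x∉S′ : ¬ x ∈ S′
  x∉S′ x∈ with () ← trans (sym (lookup∘update x S outside)) ([]=⇒lookup x∈)
  stays : ∀ {y} → ¬ x ≡ y × y ∈ S → y ∈ S′
  stays {y} (x≢y , y∈) = lookup⇒[]= y S′ (trans (lookup∘update′ (x≢y ∘ sym) S outside) ([]=⇒lookup y∈))
  S′⊂S : S′ ⊂ S
  S′⊂S = shrink , x , x∈S , x∉S′
    where
    shrink : ∀ {y} → y ∈ S′ → y ∈ S
    shrink {y} y∈ with y ≟ᶠ x
    ... | yes refl = contradiction y∈ x∉S′
    ... | no y≢x = lookup⇒[]= y S (trans (sym (lookup∘update′ y≢x S outside)) ([]=⇒lookup y∈))

record ClusterViolation (H : Graph) (C : ℕ) (c : Fin (n H) → ℕ) : Set where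
  field
    S        : Subset (n H)
    mono     : Monochromatic H c S
    conn     : ConnectedIn H S
    members  : List (Fin (n H))
    unique   : Unique members
    members⊆ : All (_∈ S) members
    large    : C < length members

violation⇒¬clustering : ∀ {H C c} → ClusterViolation H C c → ¬ HasClustering H C c
violation⇒¬clustering v clustered =
  <⇒≱ (<-≤-trans large (length≤∣∣ S unique members⊆)) (clustered S mono conn)
  where open ClusterViolation v

module _ {G H : Graph} (iso : G ≅ H) where
  open _≅_ iso
  open Inverse bij

  from-injective : ∀ {x y} → from x ≡ from y → x ≡ y
  from-injective {x} {y} eq = trans (sym (strictlyInverseˡ x)) (trans (cong to eq) (strictlyInverseˡ y))

  violation-transport : ∀ {C} c → ClusterViolation H C (c ∘ from) → ClusterViolation G C c
  violation-transport {C} c v = record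
    { S = SG ; mono = monoG ; conn = connG ; members = map from members
    ; unique = Unique.map⁺ from-injective unique
    ; members⊆ = All.map⁺ (All.map from∈ members⊆)
    ; large = subst (C <_) (sym (length-map from members)) large }
    where
    open ClusterViolation v
    SG : Subset (n G)
    SG = fromDec (λ u → to u ∈? S)
    to∈ : ∀ {u} → u ∈ SG → to u ∈ S
    to∈ = ∈-fromDec⁻ (λ u → to u ∈? S)
    from∈ : ∀ {w} → w ∈ S → from w ∈ SG
    from∈ {w} w∈ = ∈-fromDec⁺ (λ u → to u ∈? S) (subst (_∈ S) (sym (strictlyInverseˡ w)) w∈)
    monoG : Monochromatic G c SG
    monoG u v u∈ v∈ = begin
      c u              ≡⟨ cong c (strictlyInverseʳ u) ⟨
      c (from (to u))  ≡⟨ mono (to u) (to v) (to∈ u∈) (to∈ v∈) ⟩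
      c (from (to v))  ≡⟨ cong c (strictlyInverseʳ v) ⟩
      c v              ∎
      where open ≡-Reasoning
    reach : ∀ {x y} → ReachIn H S x y → ReachIn G SG (from x) (from y)
    reach (here x∈) = here (from∈ x∈)
    reach (step {x} {w} x∈ xw r) = step (from∈ x∈)
      (trans (preserve (from x) (from w))
        (trans (cong₂ (adj H) (strictlyInverseˡ x) (strictlyInverseˡ w)) xw))
      (reach r)
    connG : ConnectedIn G SG
    connG u v u∈ v∈ = subst₂ (ReachIn G SG) (strictlyInverseʳ u) (strictlyInverseʳ v)
      (reach (conn (to u) (to v) (to∈ u∈) (to∈ v∈)))

-- Pull the lists back along the isomorphism, colour G, and push the colouring forward.
uncolourable⇒¬≅ : ∀ {G H C t} → χˡ≤ C G t → (lists : ListAssignment t H) →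
  (∀ c → (∀ v → c v ∈ₗ L lists v) → ClusterViolation H C c) → ¬ (G ≅ H)
uncolourable⇒¬≅ {G} {H} χ≤ lists uncolourable iso =
  violation⇒¬clustering (violation-transport iso c (uncolourable (c ∘ from) c∈)) clustered
  where
  open Inverse (_≅_.bij iso)
  pulled : ListAssignment _ G
  pulled = record { L = L lists ∘ to ; distinct = distinct lists ∘ to ; big = big lists ∘ to }
  c : Fin (n G) → ℕ
  c = proj₁ (χ≤ pulled)
  c∈pulled : ∀ v → c v ∈ₗ L lists (to v)
  c∈pulled = proj₁ (proj₂ (χ≤ pulled))
  clustered : HasClustering G _ c
  clustered = proj₂ (proj₂ (χ≤ pulled))
  c∈ : ∀ w → c (from w) ∈ₗ L lists w
  c∈ w = subst (λ x → c (from w) ∈ₗ L lists x) (strictlyInverseˡ w) (c∈pulled (from w))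

module _ {H : Graph} {S : Subset (n H)} where

  reach-trans : ∀ {x y z} → ReachIn H S x y → ReachIn H S y z → ReachIn H S x z
  reach-trans (here _) r = r
  reach-trans (step x∈ xw r) r′ = step x∈ xw (reach-trans r r′)

  reach-snoc : ∀ {x y z} → ReachIn H S x y → adj H y z ≡ true → z ∈ S → ReachIn H S x z
  reach-snoc (here y∈) yz z∈ = step y∈ yz (here z∈)
  reach-snoc (step x∈ xw r) yz z∈ = step x∈ xw (reach-snoc r yz z∈)

  reach-sym : ∀ {x y} → ReachIn H S x y → ReachIn H S y x
  reach-sym (here x∈) = here x∈
  reach-sym (step {x} {w} x∈ xw r) = reach-snoc (reach-sym r) (trans (adj-sym H w x) xw) x∈

  reach-last : ∀ {k} (q : Fin (suc k) → Fin (n H)) → (∀ o → q o ∈ S) →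
    (∀ o → adj H (q (inject₁ o)) (q (fsuc o)) ≡ true) → ∀ o → ReachIn H S (q o) (q (fromℕ k))
  reach-last {zero}  q q∈ q-adj fzero    = here (q∈ fzero)
  reach-last {suc k} q q∈ q-adj fzero    =
    step (q∈ fzero) (q-adj fzero) (reach-last (q ∘ fsuc) (q∈ ∘ fsuc) (q-adj ∘ fsuc) fzero)
  reach-last {suc k} q q∈ q-adj (fsuc o) = reach-last (q ∘ fsuc) (q∈ ∘ fsuc) (q-adj ∘ fsuc) o

module _ {H : Graph} {C : ℕ} {c : Fin (n H) → ℕ} where

  star-violation : ∀ a (ys : List (Fin (n H))) → Unique ys →
    All (λ y → adj H a y ≡ true × c y ≡ c a) ys → C < length ys → ClusterViolation H C c
  star-violation a ys ys! ys-nbrs C<ys = record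
    { S = S ; mono = mono ; conn = conn ; members = ys ; unique = ys!
    ; members⊆ = All.map (λ (ay , cy) → ∈-fromDec⁺ star? (cy , inj₂ ay)) ys-nbrs ; large = C<ys }
    where
    star? : Decidable (λ v → c v ≡ c a × (v ≡ a ⊎ adj H a v ≡ true))
    star? v = (c v ≟ c a) ×-dec ((v ≟ᶠ a) ⊎-dec (adj H a v Bool.≟ true))
    S = fromDec star?
    mono : Monochromatic H c S
    mono u v u∈ v∈ = trans (proj₁ (∈-fromDec⁻ star? u∈)) (sym (proj₁ (∈-fromDec⁻ star? v∈)))
    a∈ : a ∈ S
    a∈ = ∈-fromDec⁺ star? (refl , inj₁ refl)
    to-a : ∀ {v} → v ∈ S → ReachIn H S v a
    to-a {v} v∈ with proj₂ (∈-fromDec⁻ star? v∈)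
    ... | inj₁ refl = here v∈
    ... | inj₂ av   = step v∈ (trans (adj-sym H v a) av) (here a∈)
    conn : ConnectedIn H S
    conn u v u∈ v∈ = reach-trans (to-a u∈) (reach-sym (to-a v∈))

  path-violation : ∀ (p : Fin (suc C) → Fin (n H)) → (∀ {o o′} → p o ≡ p o′ → o ≡ o′) →
    ∀ x → (∀ o → c (p o) ≡ x) → (∀ o → adj H (p (inject₁ o)) (p (fsuc o)) ≡ true) →
    ClusterViolation H C c
  path-violation p p-injective x p-colour p-adj = record
    { S = S ; mono = mono ; conn = conn ; members = map p (allFin (suc C))
    ; unique = Unique.map⁺ p-injective (Unique.allFin⁺ (suc C))
    ; members⊆ = All.map⁺ (All.tabulate⁺ p∈)
    ; large = subst (C <_) (sym (trans (length-map p (allFin (suc C))) (length-tabulate (λ o → o)))) ≤-refl }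
    where
    path? : Decidable (λ v → ∃ λ o → v ≡ p o)
    path? v = any? (λ o → v ≟ᶠ p o)
    S = fromDec path?
    p∈ : ∀ o → p o ∈ S
    p∈ o = ∈-fromDec⁺ path? (o , refl)
    mono : Monochromatic H c S
    mono u v u∈ v∈ with ∈-fromDec⁻ path? u∈ | ∈-fromDec⁻ path? v∈
    ... | o , refl | o′ , refl = trans (p-colour o) (sym (p-colour o′))
    conn : ConnectedIn H S
    conn u v u∈ v∈ with ∈-fromDec⁻ path? u∈ | ∈-fromDec⁻ path? v∈
    ... | o , refl | o′ , refl = reach-trans (reach-last p p∈ p-adj o) (reach-sym (reach-last p p∈ p-adj o′))

length-filter+length-filter-∁ : ∀ {a} {A : Set a} {P : Pred A a} (P? : Decidable P) xs →
  length (filter P? xs) + length (filter (∁? P?) xs) ≡ length xs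
length-filter+length-filter-∁ P? [] = refl
length-filter+length-filter-∁ P? (x ∷ xs) with P? x
... | yes _ = cong suc (length-filter+length-filter-∁ P? xs)
... | no _  = trans (+-suc _ _) (cong suc (length-filter+length-filter-∁ P? xs))

module _ {A B : Set} (_≟_ : DecidableEquality B) (label : A → B) (C : ℕ) where

  labelled? : ∀ b → Decidable (λ x → label x ≡ b)
  labelled? b x = label x ≟ b

  pigeonhole : ∀ (bs : List B) {xs : List A} →
    Unique xs → All (λ x → label x ∈ₗ bs) xs → length bs * C < length xs →
    ∃ λ b → Σ (List A) λ ys → Unique ys × All (λ y → label y ≡ b) ys × C < length ys
  pigeonhole [] {[]} _ _ ()
  pigeonhole [] {x ∷ _} _ (() All.∷ _) _
  pigeonhole (b ∷ bs) {xs} xs! xs∈ many with C <? length (filter (labelled? b) xs)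
  ... | yes crowded =
    b , filter (labelled? b) xs , Unique.filter⁺ (labelled? b) xs! , All.all-filter (labelled? b) xs , crowded
  ... | no sparse = pigeonhole bs (Unique.filter⁺ (∁? (labelled? b)) xs!) rest∈ rest-many
    where
    rest = filter (∁? (labelled? b)) xs
    rest∈ : All (λ x → label x ∈ₗ bs) rest
    rest∈ = All.map (λ { (here eq , ¬eq) → contradiction eq ¬eq ; (there ∈bs , _) → ∈bs })
      (All.zip (All.filter⁺ (∁? (labelled? b)) xs∈ , All.all-filter (∁? (labelled? b)) xs))
    rest-many : length bs * C < length rest
    rest-many = +-cancelˡ-< C _ _ (<-≤-trans many (begin
      length xs                                         ≡⟨ length-filter+length-filter-∁ (labelled? b) xs ⟨
      length (filter (labelled? b) xs) + length rest     ≤⟨ +-monoˡ-≤ (length rest) (≮⇒≥ sparse) ⟩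
      C + length rest                                   ∎))
      where open ≤-Reasoning

-- Hub j offers the t colours ⟨j, d⟩; group f offers only ⟨j, f j⟩ for each hub j, plus e spare colours.
module Palette (t s e : ℕ) where

  hubColour : Fin s → Fin t → ℕ
  hubColour j d = toℕ (combine j d)

  spare : List ℕ
  spare = map (s * t +_) (upTo e)

  hubList : Fin s → List ℕ
  hubList j = map (hubColour j) (allFin t)

  groupList : (Fin s → Fin t) → List ℕ
  groupList f = spare ++ map (λ j → hubColour j (f j)) (allFin s)

  hubColour-injective : ∀ {j j′ d d′} → hubColour j d ≡ hubColour j′ d′ → j ≡ j′ × d ≡ d′
  hubColour-injective {j} {j′} {d} {d′} eq =
    combine-injectiveˡ j d j′ d′ (toℕ-injective eq) , combine-injectiveʳ j d j′ d′ (toℕ-injective eq)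

  hubList-unique : ∀ j → Unique (hubList j)
  hubList-unique j = Unique.map⁺ (proj₂ ∘ hubColour-injective) (Unique.allFin⁺ t)

  hubList-length : ∀ j → length (hubList j) ≡ t
  hubList-length j = trans (length-map _ (allFin t)) (length-tabulate id)

  spare-fresh : ∀ {x j d} → x ∈ₗ spare → x ≢ hubColour j d
  spare-fresh {x} {j} {d} x∈ refl with ∈-map⁻ (s * t +_) x∈
  ... | i , _ , eq = <⇒≱ (toℕ<n (combine j d)) (subst (s * t ≤_) (sym eq) (m≤m+n (s * t) i))

  groupList-unique : ∀ f → Unique (groupList f)
  groupList-unique f = Unique.++⁺
    (Unique.map⁺ (+-cancelˡ-≡ (s * t) _ _) (Unique.upTo⁺ e))
    (Unique.map⁺ (proj₁ ∘ hubColour-injective) (Unique.allFin⁺ s))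
    λ (x∈spare , x∈hubs) →
      let (j , _ , eq) = ∈-map⁻ (λ j → hubColour j (f j)) x∈hubs in spare-fresh x∈spare eq

  groupList-length : ∀ f → length (groupList f) ≡ e + s
  groupList-length f = trans (length-++ spare) (cong₂ _+_
    (trans (length-map _ (upTo e)) (length-upTo e)) (trans (length-map _ (allFin s)) (length-tabulate id)))

  module Core {H : Graph} {C N : ℕ} (s*C<N : s * C < N)
    (hub : Fin s → Fin (n H)) (member : (Fin s → Fin t) → Fin N → Fin (suc C) → Fin (n H))
    (member-injective : ∀ {f w w′ o o′} → member f w o ≡ member f w′ o′ → w ≡ w′ × o ≡ o′)
    (hub-adj : ∀ j f w o → adj H (hub j) (member f w o) ≡ true)
    (c : Fin (n H) → ℕ) (c-hub : ∀ j → c (hub j) ∈ₗ hubList j)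
    (c-member : ∀ f w o → c (member f w o) ∈ₗ groupList f)
    where

    hub-digit : ∀ j → ∃ λ d → c (hub j) ≡ hubColour j d
    hub-digit j with d , _ , eq ← ∈-map⁻ (hubColour j) (c-hub j) = d , eq

    digits : Fin s → Fin t
    digits = proj₁ ∘ hub-digit

    echo-or-spare : ∀ w o → (∃ λ j → c (member digits w o) ≡ c (hub j)) ⊎ c (member digits w o) ∈ₗ spare
    echo-or-spare w o with ∈-++⁻ spare (c-member digits w o)
    ... | inj₁ ∈spare = inj₂ ∈spare
    ... | inj₂ ∈hubs with j , _ , eq ← ∈-map⁻ (λ j → hubColour j (digits j)) ∈hubs =
      inj₁ (j , trans eq (sym (proj₂ (hub-digit j))))

    Echo : Fin N → Set
    Echo w = ∃₂ λ o j → c (member digits w o) ≡ c (hub j)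

    echo? : ∀ w → Dec (Echo w)
    echo? w = any? (λ o → any? (λ j → c (member digits w o) ≟ c (hub j)))

    -- Each of the N > s·C rows echoes some hub, so C + 1 of them echo the same hub: a star.
    module _ (echo : ∀ w → Echo w) where

      echoed : Fin N → Fin s
      echoed w = proj₁ (proj₂ (echo w))

      echoer : Fin N → Fin (n H)
      echoer w = member digits w (proj₁ (echo w))

      echoer-spoke : ∀ {j w} → echoed w ≡ j → adj H (hub j) (echoer w) ≡ true × c (echoer w) ≡ c (hub j)
      echoer-spoke {j} {w} refl = hub-adj j digits w _ , proj₂ (proj₂ (echo w))

      echoes-violation : ClusterViolation H C c
      echoes-violation with pigeonhole _≟ᶠ_ echoed C (allFin s)
        (Unique.allFin⁺ N) (All.tabulate⁺ (λ w → ∈-allFin (echoed w))) bound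
        where
        bound : length (allFin s) * C < length (allFin N)
        bound = subst₂ (λ a b → a * C < b)
          (sym (length-tabulate {n = s} id)) (sym (length-tabulate {n = N} id)) s*C<N
      ... | j , ws , ws! , ws-echo-j , C<ws =
        star-violation (hub j) (map echoer ws) (Unique.map⁺ (proj₁ ∘ member-injective) ws!)
          (All.map⁺ (All.map echoer-spoke ws-echo-j)) (subst (C <_) (sym (length-map echoer ws)) C<ws)

    violation-or-spare-row : ClusterViolation H C c ⊎ ∃₂ λ f w → ∀ o → c (member f w o) ∈ₗ spare
    violation-or-spare-row with all? echo?
    ... | yes echo = inj₁ (echoes-violation echo)
    ... | no ¬echo with w , ¬echo-w ← ¬∀⟶∃¬ N Echo echo? ¬echo =
      inj₂ (digits , w , λ o →
        [ (λ (j , eq) → contradiction (o , j , eq) ¬echo-w) , id ]′ (echo-or-spare w o))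

↑ˡ-<ᵇ : ∀ {s} (i : Fin s) m → (toℕ (i ↑ˡ m) <ᵇ s) ≡ true
↑ˡ-<ᵇ fzero    m = refl
↑ˡ-<ᵇ (fsuc i) m = ↑ˡ-<ᵇ i m

↑ʳ-<ᵇ : ∀ s {m} (x : Fin m) → (toℕ (s ↑ʳ x) <ᵇ s) ≡ false
↑ʳ-<ᵇ zero    x = refl
↑ʳ-<ᵇ (suc s) x = ↑ʳ-<ᵇ s x

pathAdj-suc : ∀ a → pathAdj a (suc a) ≡ true
pathAdj-suc zero    = refl
pathAdj-suc (suc a) = pathAdj-suc a

K-adj : ∀ {s m} (i : Fin s) (x : Fin m) → adj (K s m) (i ↑ˡ m) (s ↑ʳ x) ≡ true
K-adj {s} {m} i x rewrite ↑ˡ-<ᵇ i m | ↑ʳ-<ᵇ s x = refl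

IP-adj : ∀ {s m} (i : Fin s) (x : Fin m) → adj (IP s m) (i ↑ˡ m) (s ↑ʳ x) ≡ true
IP-adj {s} {m} i x rewrite ↑ˡ-<ᵇ i m | ↑ʳ-<ᵇ s x = refl

IP-path-adj : ∀ {s m} (x y : Fin m) → toℕ y ≡ suc (toℕ x) → adj (IP s m) (s ↑ʳ x) (s ↑ʳ y) ≡ true
IP-path-adj {s} x y y≡x+1
  rewrite ↑ʳ-<ᵇ s x | ↑ʳ-<ᵇ s y | toℕ-↑ʳ s x | toℕ-↑ʳ s y | y≡x+1 | +-suc s (toℕ x) = pathAdj-suc (s + toℕ x)

toℕ-combine-next : ∀ {a b} (i : Fin a) {j j′ : Fin b} → toℕ j′ ≡ suc (toℕ j) →
  toℕ (combine i j′) ≡ suc (toℕ (combine i j))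
toℕ-combine-next {b = b} i {j} {j′} j′≡j+1 = begin
  toℕ (combine i j′)         ≡⟨ toℕ-combine i j′ ⟩
  b * toℕ i + toℕ j′         ≡⟨ cong (b * toℕ i +_) j′≡j+1 ⟩
  b * toℕ i + suc (toℕ j)    ≡⟨ +-suc (b * toℕ i) (toℕ j) ⟩
  suc (b * toℕ i + toℕ j)    ≡⟨ cong suc (toℕ-combine i j) ⟨
  suc (toℕ (combine i j))    ∎
  where open ≡-Reasoning

module Construction (t C : ℕ) where

  rows : ℕ
  rows = suc (t * C)

  m : ℕ
  m = t ^ t * (rows * suc C)

  -- s hubs, then t^t groups of `rows` rows of C + 1 vertices; group k gets the lists groupList (decode k).
  module Layout (s e : ℕ) (encode : (Fin s → Fin t) → Fin (t ^ t)) (decode : Fin (t ^ t) → Fin s → Fin t)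
    (decode-encode : ∀ f j → decode (encode f) j ≡ f j) where

    open Palette t s e public

    hub : Fin s → Fin (s + m)
    hub j = j ↑ˡ m

    member : (Fin s → Fin t) → Fin rows → Fin (suc C) → Fin (s + m)
    member f w o = s ↑ʳ combine (encode f) (combine w o)

    member-injective : ∀ {f w w′ o o′} → member f w o ≡ member f w′ o′ → w ≡ w′ × o ≡ o′
    member-injective {f} {w} {w′} {o} {o′} eq =
      combine-injectiveˡ w o w′ o′ same-cell , combine-injectiveʳ w o w′ o′ same-cell
      where
      same-cell : combine w o ≡ combine w′ o′
      same-cell = combine-injectiveʳ (encode f) _ (encode f) _ (↑ʳ-injective s _ _ eq)

    lists : Fin (s + m) → List ℕ
    lists v = [ hubList , groupList ∘ decode ∘ quotient (rows * suc C) ]′ (splitAt s v)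

    lists-unique : ∀ v → Unique (lists v)
    lists-unique v with splitAt s v
    ... | inj₁ j = hubList-unique j
    ... | inj₂ r = groupList-unique _

    lists-length : e + s ≡ t → ∀ v → t ≤ length (lists v)
    lists-length size v with splitAt s v
    ... | inj₁ j = ≤-reflexive (sym (hubList-length j))
    ... | inj₂ r = ≤-reflexive (trans (sym size) (sym (groupList-length _)))

    lists-hub : ∀ j → lists (hub j) ≡ hubList j
    lists-hub j rewrite splitAt-↑ˡ s j m = refl

    lists-member : ∀ f w o → lists (member f w o) ≡ groupList f
    lists-member f w o rewrite splitAt-↑ʳ s m (combine (encode f) (combine w o)) = begin
      groupList (decode (quotient (rows * suc C) (combine (encode f) (combine w o))))
        ≡⟨ cong (groupList ∘ decode ∘ proj₁) (remQuot-combine (encode f) (combine w o)) ⟩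
      groupList (decode (encode f))
        ≡⟨ cong (spare ++_) (map-cong (λ j → cong (hubColour j) (decode-encode f j)) (allFin s)) ⟩
      groupList f ∎
      where open ≡-Reasoning

    module _ {c : Fin (s + m) → ℕ} (c∈ : ∀ v → c v ∈ₗ lists v) where

      hub-colour : ∀ j → c (hub j) ∈ₗ hubList j
      hub-colour j = subst (c (hub j) ∈ₗ_) (lists-hub j) (c∈ (hub j))

      member-colour : ∀ f w o → c (member f w o) ∈ₗ groupList f
      member-colour f w o = subst (c (member f w o) ∈ₗ_) (lists-member f w o) (c∈ (member f w o))

module _ (t C : ℕ) where
  open Construction t C
  open Layout t 0 funToFin finToFun finToFun-funToFin

  K-lists : ListAssignment t (K t m)
  K-lists = record { L = lists ; distinct = lists-unique ; big = lists-length refl }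

  -- With no spare colours the group named by the hubs' colours must echo them.
  K-uncolourable : ∀ c → (∀ v → c v ∈ₗ L K-lists v) → ClusterViolation (K t m) C c
  K-uncolourable c c∈ with Core.violation-or-spare-row {H = K t m} (n<1+n (t * C))
    hub member member-injective (λ j _ _ _ → K-adj j _) c (hub-colour c∈) (member-colour c∈)
  ... | inj₁ violation = violation
  ... | inj₂ (_ , _ , spare-row) with () ← spare-row fzero

module _ (u C : ℕ) where
  open Construction (suc u) C

  -- Groups are named by the last u digits of an index in Fin ((1 + u) ^ (1 + u)).
  encode : (Fin u → Fin (suc u)) → Fin (suc u ^ suc u)
  encode f = combine {suc u} {suc u ^ u} fzero (funToFin f)

  decode : Fin (suc u ^ suc u) → Fin u → Fin (suc u)
  decode k = finToFun (remainder {suc u} (suc u ^ u) k)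

  decode-encode : ∀ f j → decode (encode f) j ≡ f j
  decode-encode f j =
    trans (cong (λ r → finToFun (proj₂ r) j) (remQuot-combine {k = suc u ^ u} fzero (funToFin f)))
      (finToFun-funToFin f j)

  open Layout u 1 encode decode decode-encode

  IP-lists : ListAssignment (suc u) (IP u m)
  IP-lists = record { L = lists ; distinct = lists-unique ; big = lists-length refl }

  -- A row avoiding all hub colours is coloured by the single spare colour, and it is a path.
  IP-uncolourable : ∀ c → (∀ v → c v ∈ₗ L IP-lists v) → ClusterViolation (IP u m) C c
  IP-uncolourable c c∈ with Core.violation-or-spare-row {H = IP u m} (s≤s (*-monoˡ-≤ C (n≤1+n u)))
    hub member member-injective (λ j _ _ _ → IP-adj {m = m} j _) c (hub-colour c∈) (member-colour c∈)
  ... | inj₁ violation = violation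
  ... | inj₂ (f , w , spare-row) =
    path-violation (member f w) (proj₂ ∘ member-injective {f} {w} {w}) (u * suc u + 0) spare-colour row-adj
    where
    spare-colour : ∀ o → c (member f w o) ≡ u * suc u + 0
    spare-colour o with spare-row o
    ... | here eq = eq
    row-adj : ∀ o → adj (IP u m) (member f w (inject₁ o)) (member f w (fsuc o)) ≡ true
    row-adj o = IP-path-adj {s = u} _ _
      (toℕ-combine-next (encode f) (toℕ-combine-next w (cong suc (sym (toℕ-inject₁ o)))))

corollary6 : (t : ℕ) → 1 ≤ t → (𝒢 : Graph → Set) → χˡ⋆≤ 𝒢 t →
    ∃ λ m → 1 ≤ m × (∀ G → 𝒢 G → ¬ (G ≅ K t m)) × (∀ G → 𝒢 G → ¬ (G ≅ IP (t ∸ 1) m))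
corollary6 (suc u) _ 𝒢 (C , χ≤) =
  m , *-mono-≤ (m^n>0 (suc u) (suc u)) (s≤s z≤n) ,
  (λ G G∈𝒢 → uncolourable⇒¬≅ (χ≤ G G∈𝒢) (K-lists (suc u) C) (K-uncolourable (suc u) C)) ,
  (λ G G∈𝒢 → uncolourable⇒¬≅ (χ≤ G G∈𝒢) (IP-lists u C) (IP-uncolourable u C))
  where open Construction (suc u) C
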